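{- Let $S$ be an infinite, finitely synchronizing semigroup. For each finite coloring of $S$, there is an infinite almost-monochromatic subsemigroup of $S$.
   Context: A semigroup $S$ is finitely synchronizing if there is a finite $F\subseteq S$ such that $ab\in\{a,b\}\cup F$ for all $a,b\in S$. A finite coloring of a set assigns one of finitely many colors to each element. A colored set $A$ is almost-monochromatic if all but finitely many members of $A$ have the same color. -}

module Defs where

open import Level using (Level; _⊔_)
open import Algebra.Bundles using (Semigroup)
open import Data.List using (List)
open import Data.List.Relation.Unary.Any using (Any)
open import Data.Fin using (Fin)
open import Data.Nat using (ℕ)
open import Data.Sum using (_⊎_)
open import Data.Product using (Σ; ∃; _×_)
open import Relation.Nullary using (¬_)
open import Relation.Binary.PropositionalEquality using (_≡_)

module _ {c ℓ : Level} (S : Semigroup c ℓ) where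
  open Semigroup S

  _∈ₗ_ : Carrier → List Carrier → Set (c ⊔ ℓ)
  x ∈ₗ L = Any (x ≈_) L

  FiniteSubset : ∀ {p} → (Carrier → Set p) → Set (c ⊔ ℓ ⊔ p)
  FiniteSubset P = Σ (List Carrier) λ L → ∀ x → P x → x ∈ₗ L

  InfiniteSubset : ∀ {p} → (Carrier → Set p) → Set (c ⊔ ℓ ⊔ p)
  InfiniteSubset P = ¬ FiniteSubset P

  Infinite : Set (c ⊔ ℓ)
  Infinite = InfiniteSubset {ℓ} (λ _ → Data.Unit.Polymorphic.⊤)
    where import Data.Unit.Polymorphic

  FinitelySynchronizing : Set (c ⊔ ℓ)
  FinitelySynchronizing =
    Σ (List Carrier) λ F → ∀ a b → (a ∙ b ≈ a) ⊎ (a ∙ b ≈ b) ⊎ ((a ∙ b) ∈ₗ F)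

  record Colouring (k : ℕ) : Set (c ⊔ ℓ) where
    field
      colour  : Carrier → Fin k
      colour-cong : ∀ {x y} → x ≈ y → colour x ≡ colour y

  IsSubsemigroup : ∀ {p} → (Carrier → Set p) → Set (c ⊔ ℓ ⊔ p)
  IsSubsemigroup P =
    (∀ {x y} → x ≈ y → P x → P y) × (∀ {x y} → P x → P y → P (x ∙ y))

  AlmostMonochromatic : ∀ {k p} → Colouring k → (Carrier → Set p) → Set (c ⊔ ℓ ⊔ p)
  AlmostMonochromatic {k} χ P =
    Σ (Fin k) λ i → FiniteSubset (λ x → P x × ¬ (Colouring.colour χ x ≡ i))

{-# OPTIONS --safe #-}
-- Some colour class C is infinite (pigeonhole, which constructively holds only
-- up to double negation). Since every product ab lies in {a, b} ∪ F, the set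
-- C ∪ F is a subsemigroup; it is infinite because it contains C, and its only
-- members of another colour lie in the finite set F.
module Submission where

open import Defs
open import Level using (Level; _⊔_; Lift; lift)
open import Algebra.Bundles using (Semigroup)
open import Data.Nat using (ℕ; zero; suc)
open import Data.Fin using (Fin; zero; suc)
open import Data.Product using (Σ; ∃; _×_; _,_; proj₁; proj₂)
open import Data.Sum using (_⊎_; inj₁; inj₂)
open import Data.List using (List; concat; tabulate)
import Data.List.Relation.Unary.Any as Any
open import Data.List.Relation.Unary.Any.Properties using (concat⁺; tabulate⁺)
open import Relation.Nullary using (¬_)
open import Relation.Nullary.Negation using (¬¬-map; contradiction)
open import Relation.Binary.PropositionalEquality as ≡ using (_≡_; refl)

¬¬-∀Fin : ∀ {a} {k : ℕ} {Q : Fin k → Set a} → (∀ i → ¬ ¬ Q i) → ¬ ¬ (∀ i → Q i)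
¬¬-∀Fin {k = zero}      ¬¬Q ¬∀Q = ¬∀Q (λ ())
¬¬-∀Fin {k = suc k} {Q} ¬¬Q ¬∀Q =
  ¬¬Q zero λ Q₀ → ¬¬-∀Fin {Q = λ i → Q (suc i)} (λ i → ¬¬Q (suc i))
    λ Qₛ → ¬∀Q λ { zero → Q₀ ; (suc i) → Qₛ i }

module _ {c ℓ : Level} (S : Semigroup c ℓ) where
  open Semigroup S using (Carrier; _≈_; _∙_; sym; trans)

  _∪ₗ_ : ∀ {p} → (Carrier → Set p) → List Carrier → Carrier → Set (p ⊔ c ⊔ ℓ)
  (P ∪ₗ L) x = P x ⊎ _∈ₗ_ S x L

  infinite-⊆ : ∀ {p q} {P : Carrier → Set p} {Q : Carrier → Set q} →
    (∀ x → P x → Q x) → InfiniteSubset S P → InfiniteSubset S Q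
  infinite-⊆ P⊆Q infinite-P (L , cover) = infinite-P (L , λ x Px → cover x (P⊆Q x Px))

  finite-⋃ : ∀ {p k} (P : Fin k → Carrier → Set p) →
    (∀ i → FiniteSubset S (P i)) → FiniteSubset S (λ x → ∃ λ i → P i x)
  finite-⋃ P finite =
    concat (tabulate λ i → proj₁ (finite i)) ,
    λ { x (i , Pix) → concat⁺ (tabulate⁺ i (proj₂ (finite i) x Pix)) }

  ∈ₗ-resp-≈ : ∀ {x y} L → x ≈ y → _∈ₗ_ S x L → _∈ₗ_ S y L
  ∈ₗ-resp-≈ L x≈y = Any.map (trans (sym x≈y))

  ∪-synchronizer-isSubsemigroup : ∀ {p} (sync : FinitelySynchronizing S)
    (P : Carrier → Set p) → (∀ {x y} → x ≈ y → P x → P y) →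
    IsSubsemigroup S (P ∪ₗ proj₁ sync)
  ∪-synchronizer-isSubsemigroup (F , sync) P P-resp-≈ = ∪-resp-≈ , ∪-mul
    where
    ∪-resp-≈ : ∀ {x y} → x ≈ y → (P ∪ₗ F) x → (P ∪ₗ F) y
    ∪-resp-≈ x≈y (inj₁ Px)  = inj₁ (P-resp-≈ x≈y Px)
    ∪-resp-≈ x≈y (inj₂ x∈F) = inj₂ (∈ₗ-resp-≈ F x≈y x∈F)

    ∪-mul : ∀ {x y} → (P ∪ₗ F) x → (P ∪ₗ F) y → (P ∪ₗ F) (x ∙ y)
    ∪-mul {x} {y} x∈ y∈ with sync x y
    ... | inj₁ xy≈x        = ∪-resp-≈ (sym xy≈x) x∈
    ... | inj₂ (inj₁ xy≈y) = ∪-resp-≈ (sym xy≈y) y∈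
    ... | inj₂ (inj₂ xy∈F) = inj₂ xy∈F

  module _ {k : ℕ} (χ : Colouring S k) where
    open Colouring χ

    ColourClass : Fin k → Carrier → Set (c ⊔ ℓ)
    ColourClass i x = Lift (c ⊔ ℓ) (colour x ≡ i)

    ColourClass-resp-≈ : ∀ i {x y} → x ≈ y → ColourClass i x → ColourClass i y
    ColourClass-resp-≈ i x≈y (lift χx≡i) = lift (≡.trans (≡.sym (colour-cong x≈y)) χx≡i)

    infinite-colourClass : Infinite S → ¬ ¬ ∃ λ i → InfiniteSubset S (ColourClass i)
    infinite-colourClass infinite ¬∃ =
      ¬¬-∀Fin (λ i infinite-i → ¬∃ (i , infinite-i)) λ finite →
        let (L , cover) = finite-⋃ ColourClass finite in
        infinite (L , λ x _ → cover x (colour x , lift refl))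

    almostMonochromatic-colourClass-∪ : ∀ i F →
      AlmostMonochromatic S χ (ColourClass i ∪ₗ F)
    almostMonochromatic-colourClass-∪ i F = i , F , λ
      { x (inj₁ (lift χx≡i) , χx≢i) → contradiction χx≡i χx≢i
      ; x (inj₂ x∈F , _)            → x∈F
      }

lemma3p4 : {c ℓ : Level} (S : Semigroup c ℓ) → Infinite S → FinitelySynchronizing S →
    (k : ℕ) (χ : Colouring S k) →
    ¬ ¬ Σ (Semigroup.Carrier S → Set (c Level.⊔ ℓ)) λ P →
      IsSubsemigroup S P × InfiniteSubset S P × AlmostMonochromatic S χ P
lemma3p4 {c} {ℓ} S infinite sync@(F , _) k χ =
  ¬¬-map colourClass-∪-synchronizer (infinite-colourClass S χ infinite)
  where
  colourClass-∪-synchronizer : (∃ λ i → InfiniteSubset S (ColourClass S χ i)) →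
    Σ (Semigroup.Carrier S → Set (c ⊔ ℓ)) λ P →
      IsSubsemigroup S P × InfiniteSubset S P × AlmostMonochromatic S χ P
  colourClass-∪-synchronizer (i , infinite-i) =
    _∪ₗ_ S (ColourClass S χ i) F ,
    ∪-synchronizer-isSubsemigroup S sync (ColourClass S χ i) (ColourClass-resp-≈ S χ i) ,
    infinite-⊆ S (λ _ → inj₁) infinite-i ,
    almostMonochromatic-colourClass-∪ S χ i F
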